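{- Let $\mathcal P$ be a finite poset and let $A_1,\dots,A_k\in\binom{[w^*(\mathcal P)]}{\le h^*(\mathcal P)}$ be distinct sets that induce a copy of $\mathcal P$ (under inclusion). Then for every $a\in[w^*(\mathcal P)]$ there exist $i,j\in[k]$ such that $A_i\setminus A_j=\{a\}$.
   Context: For integers $h\le n$, $\binom{[n]}{\le h}$ denotes the induced subposet of the hypercube $Q_n$ (subsets of $[n]=\{1,\dots,n\}$ ordered by inclusion) consisting of all sets of size at most $h$. A poset contains an induced copy of $\mathcal P$ if it has a subset which, with the induced order, is isomorphic to $\mathcal P$. The cube-height $h^*(\mathcal P)$ is the minimum $h\in\mathbb N$ for which there exists $n\in\mathbb N$ such that $\binom{[n]}{\le h}$ contains an induced copy of $\mathcal P$. The cube-width $w^*(\mathcal P)$ is the minimum $w\in\mathbb N$ such that $\binom{[w]}{\le h^*(\mathcal P)}$ contains an induced copy of $\mathcal P$. -}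

module Defs where

open import Data.Nat using (ℕ; _≤_)
open import Data.Fin using (Fin)
open import Data.Fin.Subset using (Subset; _⊆_; ∣_∣)
open import Data.Product using (Σ; ∃; _×_)
open import Relation.Binary.PropositionalEquality using (_≡_)
open import Relation.Binary.Structures using (IsPartialOrder)
open import Function.Bundles using (_⇔_)
open import Function.Definitions using (Injective)

-- A finite poset: carrier Fin m (any finite poset is isomorphic to one of
-- this form) with a partial order relation.
record FinPoset : Set₁ where
  field
    size      : ℕ
    _≼_       : Fin size → Fin size → Set
    isPartialOrder : IsPartialOrder _≡_ _≼_

open FinPoset public

IsInducedCopy : (P : FinPoset) (n h : ℕ) → (Fin (size P) → Subset n) → Set
IsInducedCopy P n h A =
  Injective _≡_ _≡_ A
  × (∀ x → ∣ A x ∣ ≤ h)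
  × (∀ x y → (_≼_ P x y ⇔ (A x ⊆ A y)))

HasInducedCopy : (P : FinPoset) (n h : ℕ) → Set
HasInducedCopy P n h = Σ (Fin (size P) → Subset n) (IsInducedCopy P n h)

IsCubeHeight : FinPoset → ℕ → Set
IsCubeHeight P h =
  (∃ λ n → HasInducedCopy P n h)
  × (∀ h′ n → HasInducedCopy P n h′ → h ≤ h′)

IsCubeWidth : FinPoset → ℕ → ℕ → Set
IsCubeWidth P h w =
  IsCubeHeight P h
  × HasInducedCopy P w h
  × (∀ w′ → HasInducedCopy P w′ h → w ≤ w′)

{-# OPTIONS --safe #-}
-- Deleting a coordinate a from every set of an induced copy in Q_{w*} keeps
-- all sizes at most h*, and it can only create new inclusions A_i ⊆ A_j when
-- A_i and A_j differ exactly in a, i.e. A_i ─ A_j = {a}. If no such pair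
-- existed, the result would be an induced copy of P in Q_{w*-1} of height h*,
-- contradicting the minimality of w*.
module Submission where

open import Defs
open import Data.Nat using (ℕ; suc; _≤_; s≤s)
open import Data.Nat.Properties using (≤-refl; ≤-trans; m≤n⇒m≤1+n; 1+n≰n)
open import Data.Bool using () renaming (_≟_ to _≟ᴮ_)
open import Data.Fin using (Fin; zero; suc; punchIn)
open import Data.Fin.Properties using (any?; punchInᵢ≢i; punchIn-punchOut; punchOut-punchIn)
  renaming (_≟_ to _≟ᶠ_)
open import Data.Fin.Subset using (Subset; _─_; ⁅_⁆; _⊆_; _∈_; _∉_; ∣_∣; inside; outside)
open import Data.Fin.Subset.Properties
  using (_∈?_; ⊆-antisym; ⊆-reflexive; x∈⁅x⁆; x∈⁅y⁆⇒x≡y; x∈p∧x∉q⇒x∈p─q; p─q⊆p)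
open import Data.Vec using (_∷_; lookup; removeAt; here; there)
open import Data.Vec.Properties using (≡-dec; []=⇒lookup; lookup⇒[]=; removeAt-punchOut)
open import Data.Product using (∃₂; _,_)
open import Data.Sum using (_⊎_; inj₁; inj₂)
open import Relation.Nullary using (yes; no; contradiction)
open import Relation.Binary.PropositionalEquality using (_≡_; _≢_; refl; sym; trans; cong; subst)
open import Function using (_∘_)
open import Function.Bundles using (_⇔_; mk⇔; Equivalence)

private
  variable
    n : ℕ

x∈p─q⇒x∉q : ∀ {x : Fin n} (p q : Subset n) → x ∈ p ─ q → x ∉ q
x∈p─q⇒x∉q (_ ∷ p) (outside ∷ q) here      ()
x∈p─q⇒x∉q (_ ∷ p) (_       ∷ q) (there m) (there x∈q) = x∈p─q⇒x∉q p q m x∈q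

∣removeAt∣≤∣p∣ : ∀ (p : Subset (suc n)) i → ∣ removeAt p i ∣ ≤ ∣ p ∣
∣removeAt∣≤∣p∣ (inside  ∷ p)     zero    = m≤n⇒m≤1+n ≤-refl
∣removeAt∣≤∣p∣ (outside ∷ p)     zero    = ≤-refl
∣removeAt∣≤∣p∣ (inside  ∷ q ∷ p) (suc i) = s≤s (∣removeAt∣≤∣p∣ (q ∷ p) i)
∣removeAt∣≤∣p∣ (outside ∷ q ∷ p) (suc i) = ∣removeAt∣≤∣p∣ (q ∷ p) i

module _ {p : Subset (suc n)} {a : Fin (suc n)} where

  lookup-removeAt : ∀ k → lookup (removeAt p a) k ≡ lookup p (punchIn a k)
  lookup-removeAt k =
    trans (cong (lookup (removeAt p a)) (sym (punchOut-punchIn a)))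
          (removeAt-punchOut p (punchInᵢ≢i a k ∘ sym))

  ∈removeAt⇒punchIn∈ : ∀ {k} → k ∈ removeAt p a → punchIn a k ∈ p
  ∈removeAt⇒punchIn∈ {k} k∈ =
    lookup⇒[]= _ p (trans (sym (lookup-removeAt k)) ([]=⇒lookup k∈))

  punchIn∈⇒∈removeAt : ∀ {k} → punchIn a k ∈ p → k ∈ removeAt p a
  punchIn∈⇒∈removeAt {k} k∈ =
    lookup⇒[]= k _ (trans (lookup-removeAt k) ([]=⇒lookup k∈))

module _ {p q : Subset (suc n)} {a : Fin (suc n)} where

  removeAt-mono-⊆ : p ⊆ q → removeAt p a ⊆ removeAt q a
  removeAt-mono-⊆ p⊆q = punchIn∈⇒∈removeAt ∘ p⊆q ∘ ∈removeAt⇒punchIn∈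

  removeAt-⊆⇒∈⇒∈ : removeAt p a ⊆ removeAt q a → ∀ {j} → a ≢ j → j ∈ p → j ∈ q
  removeAt-⊆⇒∈⇒∈ sub {j} a≢j j∈p =
    subst (_∈ q) (punchIn-punchOut a≢j)
      (∈removeAt⇒punchIn∈ (sub (punchIn∈⇒∈removeAt
        (subst (_∈ p) (sym (punchIn-punchOut a≢j)) j∈p))))

  removeAt-⊆⇒⊆ : removeAt p a ⊆ removeAt q a → (a ∈ p → a ∈ q) → p ⊆ q
  removeAt-⊆⇒⊆ sub a∈⇒a∈ {j} j∈p with a ≟ᶠ j
  ... | yes refl = a∈⇒a∈ j∈p
  ... | no  a≢j  = removeAt-⊆⇒∈⇒∈ sub a≢j j∈p

  removeAt-⊆⇒─≡⁅⁆ : removeAt p a ⊆ removeAt q a → a ∈ p → a ∉ q → p ─ q ≡ ⁅ a ⁆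
  removeAt-⊆⇒─≡⁅⁆ sub a∈p a∉q = ⊆-antisym ─⊆⁅a⁆ ⁅a⁆⊆─
    where
    ─⊆⁅a⁆ : p ─ q ⊆ ⁅ a ⁆
    ─⊆⁅a⁆ {j} j∈p─q with a ≟ᶠ j
    ... | yes refl = x∈⁅x⁆ a
    ... | no  a≢j  = contradiction (removeAt-⊆⇒∈⇒∈ sub a≢j (p─q⊆p p q j∈p─q))
                                   (x∈p─q⇒x∉q p q j∈p─q)
    ⁅a⁆⊆─ : ⁅ a ⁆ ⊆ p ─ q
    ⁅a⁆⊆─ {j} j∈⁅a⁆ rewrite x∈⁅y⁆⇒x≡y a j∈⁅a⁆ = x∈p∧x∉q⇒x∈p─q a∈p a∉q

  removeAt-⊆⇒⊆⊎─≡⁅⁆ : removeAt p a ⊆ removeAt q a → p ⊆ q ⊎ p ─ q ≡ ⁅ a ⁆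
  removeAt-⊆⇒⊆⊎─≡⁅⁆ sub with a ∈? p | a ∈? q
  ... | _       | yes a∈q = inj₁ (removeAt-⊆⇒⊆ sub (λ _ → a∈q))
  ... | no  a∉p | no  _   = inj₁ (removeAt-⊆⇒⊆ sub (λ a∈p → contradiction a∈p a∉p))
  ... | yes a∈p | no  a∉q = inj₂ (removeAt-⊆⇒─≡⁅⁆ sub a∈p a∉q)

removeAt-isInducedCopy : ∀ (P : FinPoset) {h} (A : Fin (size P) → Subset (suc n)) (a : Fin (suc n)) →
  (∀ x y → A x ─ A y ≢ ⁅ a ⁆) →
  IsInducedCopy P (suc n) h A → IsInducedCopy P n h (λ x → removeAt (A x) a)
removeAt-isInducedCopy P A a no-pair (A-inj , A-size , A-order) =
  C-inj , (λ x → ≤-trans (∣removeAt∣≤∣p∣ (A x) a) (A-size x)) , C-order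
  where
  C : Fin (size P) → Subset _
  C x = removeAt (A x) a

  reflect : ∀ {x y} → C x ⊆ C y → A x ⊆ A y
  reflect {x} {y} sub with removeAt-⊆⇒⊆⊎─≡⁅⁆ sub
  ... | inj₁ A⊆ = A⊆
  ... | inj₂ ─≡ = contradiction ─≡ (no-pair x y)

  C-order : ∀ x y → (_≼_ P x y ⇔ (C x ⊆ C y))
  C-order x y = mk⇔ (removeAt-mono-⊆ ∘ Equivalence.to (A-order x y))
                    (Equivalence.from (A-order x y) ∘ reflect)

  C-inj : ∀ {x y} → C x ≡ C y → x ≡ y
  C-inj {x} {y} Cx≡Cy = A-inj (⊆-antisym (reflect (⊆-reflexive Cx≡Cy))
                                          (reflect (⊆-reflexive (sym Cx≡Cy))))

proposition2p7 : (P : FinPoset) (h w : ℕ) →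
    IsCubeHeight P h → IsCubeWidth P h w →
    (A : Fin (size P) → Subset w) → IsInducedCopy P w h A →
    (a : Fin w) → ∃₂ λ i j → (A i ─ A j) ≡ ⁅ a ⁆
proposition2p7 P h (suc n) _ (_ , _ , w-minimal) A A-copy a
  with any? (λ i → any? (λ j → ≡-dec _≟ᴮ_ (A i ─ A j) ⁅ a ⁆))
... | yes (i , j , A-i─A-j≡⁅a⁆) = i , j , A-i─A-j≡⁅a⁆
... | no  no-pair = contradiction (w-minimal n (shorter , shorter-copy)) 1+n≰n
  where
  shorter : Fin (size P) → Subset n
  shorter x = removeAt (A x) a

  shorter-copy : IsInducedCopy P n h shorter
  shorter-copy = removeAt-isInducedCopy P A a (λ i j eq → no-pair (i , j , eq)) A-copy
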